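{- Let $\gamma$ and $\delta$ be two minimal paths in $\mathscr{F}_R$ with the same itinerary. Then $\gamma$ and $\delta$ are equivalent under the action of $\mathrm{SL}_2(\mathbb{Z})$.
   Context: For a positive integer $R$, $\mathscr{F}_R$ is the directed graph with vertices integer pairs $(a,b)$ with $\gcd(a,b)\mid R$ (written $a/b$) and a directed edge from $a/b$ to $c/d$ if $ad-bc=R$. Index sets $\mathcal{I}$ are sets of consecutive integers of length at least 3 containing $0,1$; $\mathcal{I}'$ removes the least element (if any), $\mathcal{I}^*$ removes also the greatest element (if any). A path is a sequence $(a_i/b_i)_{i\in\mathcal{I}}$ with an edge from $a_{i-1}/b_{i-1}$ to $a_i/b_i$ for $i\in\mathcal{I}'$; it is minimal if the gcd of all $a_jb_i-b_ja_i$ ($i,j\in\mathcal{I}$) is $1$. The itinerary of the path is the rational sequence $\lambda_i=\frac1R(a_{i-1}b_{i+1}-b_{i-1}a_{i+1})$, $i\in\mathcal{I}^*$. $\mathrm{SL}_2(\mathbb{Z})$ acts on vertices by left multiplication on column vectors $(a,b)^T$, hence on paths. -}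

module Defs where

open import Data.Nat using (ℕ; NonZero)
open import Data.Integer using (ℤ; +_; _+_; _-_; _*_; _≤_; 0ℤ; 1ℤ)
open import Data.Integer.Divisibility using (_∣_)
open import Data.Integer.GCD using (gcd)
open import Data.Rational using (ℚ; _/_)
open import Data.Maybe using (Maybe; just; nothing)
open import Data.Product using (_×_; _,_; proj₁; proj₂; ∃)
open import Data.Unit using (⊤)
open import Relation.Binary.PropositionalEquality using (_≡_)

LowerOK : Maybe ℤ → ℤ → Set
LowerOK nothing  i = ⊤
LowerOK (just m) i = m ≤ i

UpperOK : Maybe ℤ → ℤ → Set
UpperOK nothing  i = ⊤
UpperOK (just n) i = i ≤ n

-- Length at least 3 (only a constraint when both ends are finite).
LengthOK : Maybe ℤ → Maybe ℤ → Set
LengthOK (just m) (just n) = m + + 2 ≤ n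
LengthOK _        _        = ⊤

record IndexSet : Set where
  field
    lower    : Maybe ℤ
    upper    : Maybe ℤ
    has0     : LowerOK lower 0ℤ
    has1     : UpperOK upper 1ℤ
    length≥3 : LengthOK lower upper

open IndexSet public

_∈I_ : ℤ → IndexSet → Set
i ∈I I = LowerOK (lower I) i × UpperOK (upper I) i

-- i ∈ I'  (I minus its least element): i ∈ I and i - 1 ∈ I
_∈I′_ : ℤ → IndexSet → Set
i ∈I′ I = (i ∈I I) × ((i - 1ℤ) ∈I I)

-- i ∈ I*  (I minus least and greatest elements): i - 1 ∈ I and i + 1 ∈ I
_∈I*_ : ℤ → IndexSet → Set
i ∈I* I = ((i - 1ℤ) ∈I I) × ((i + 1ℤ) ∈I I)

-- A vertex a/b is the pair (a , b).
Vertex : Set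
Vertex = ℤ × ℤ

det : Vertex → Vertex → ℤ
det (a , b) (c , d) = a * d - b * c

IsVertex : ℕ → Vertex → Set
IsVertex R (a , b) = gcd a b ∣ + R

Edge : ℕ → Vertex → Vertex → Set
Edge R v w = det v w ≡ + R

-- A path in F_R indexed by I: a sequence of vertices (values outside I are
-- irrelevant), with an edge from γ(i-1) to γ(i) for every i ∈ I'.
record IsPath (R : ℕ) (I : IndexSet) (γ : ℤ → Vertex) : Set where
  field
    vertex : ∀ i → i ∈I I → IsVertex R (γ i)
    edge   : ∀ i → i ∈I′ I → Edge R (γ (i - 1ℤ)) (γ i)

-- Minimal: the gcd of all a_j b_i - b_j a_i (i, j ∈ I) is 1, i.e. every
-- common divisor of these integers divides 1.
Minimal : IndexSet → (ℤ → Vertex) → Set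
Minimal I γ = ∀ (k : ℤ) → (∀ i j → i ∈I I → j ∈I I → k ∣ det (γ j) (γ i)) → k ∣ 1ℤ

itinerary : (R : ℕ) → .{{NonZero R}} → (ℤ → Vertex) → ℤ → ℚ
itinerary R γ i = det (γ (i - 1ℤ)) (γ (i + 1ℤ)) / R

record SL2Z : Set where
  field
    p q r s : ℤ
    det≡1   : p * s - q * r ≡ 1ℤ

open SL2Z public

act : SL2Z → Vertex → Vertex
act M (a , b) = (p M * a + q M * b , r M * a + s M * b)

SL2Equivalent : IndexSet → (ℤ → Vertex) → (ℤ → Vertex) → Set
SL2Equivalent I γ δ = ∃ λ (M : SL2Z) → ∀ i → i ∈I I → act M (γ i) ≡ δ i

{-# OPTIONS --safe #-}
-- Along a path the edge conditions det(γ_{i-1}, γ_i) = R = det(γ_i, γ_{i+1}) turn the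
-- three-term relation det(v,w) u + det(u,v) w = det(u,w) v in ℤ² into the recurrence
-- R (γ_{i-1} + γ_{i+1}) = R λ_i γ_i, so the coordinates of δ solve the recurrence of γ.
-- A solution t is determined by t_0 and t_1; choosing the linear form ℓ with ℓ(γ_0) = R t_0
-- and ℓ(γ_1) = R t_1 (possible as det(γ_0, γ_1) = R) gives ℓ(γ_i) = R t_i for all i. Then R
-- divides det(γ_j, γ_i) times each coefficient of ℓ, so by minimality of γ the form ℓ / R is
-- integral. The forms obtained from the two coordinates of δ are the rows of an integer matrix
-- M with M γ = δ, and det(δ_0, δ_1) = det M · det(γ_0, γ_1) forces det M = 1.
module Submission where

open import Defs
open import Data.Nat using (ℕ; NonZero)
open import Data.Integer using (ℤ)
open import Relation.Binary.PropositionalEquality using (_≡_)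

open import Algebra.Bundles using (AbelianGroup)
import Data.Nat.Base as ℕ
import Data.Nat.Properties as ℕ
import Data.Nat.Divisibility as ℕ
open import Data.Nat.Coprimality using (coprime-/gcd; coprime-divisor)
open import Data.Nat.DivMod using (m/n*n≡m)
open import Data.Nat.GCD using (gcd; gcd[m,n]∣m; gcd[m,n]∣n; gcd[m,n]≢0)
import Data.Integer.Base as ℤ
open import Data.Integer.Base using (+_; -[1+_]; _+_; _-_; _*_; -_; ∣_∣; 0ℤ; 1ℤ; _≤_; +≤+; -≤-; -≤+)
open import Data.Integer.Properties
  using ( ≤-refl; ≤-trans; i≤i+j; i≤j⇒i-k≤j; +-assoc; +-identityʳ; *-comm; *-identityˡ
        ; *-distribˡ-+; *-cancelˡ-≡; *-cancelʳ-≡; abs-*; +-0-abelianGroup)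
open import Algebra.Properties.Group (AbelianGroup.group +-0-abelianGroup) using (∙-cancelˡ; ∙-cancelʳ)
import Data.Integer.Divisibility.Signed as Signed
open import Data.Integer.Tactic.RingSolver using (solve-∀)
open import Data.Maybe using (nothing; just)
open import Data.Product using (_×_; _,_; proj₁; proj₂; Σ-syntax)
open import Data.Rational using (_/_)
open import Data.Rational.Properties using (/-injective-≃)
open import Data.Rational.Unnormalised using (mkℚᵘ; *≡*)
open import Data.Sum using (inj₁)
open import Data.Unit using (tt)
open import Function using (_∘_)
open import Relation.Binary.PropositionalEquality
  using (sym; trans; cong; cong₂; subst; module ≡-Reasoning)
open ≡-Reasoning

CoprimeFamily : {A : Set} → (A → ℕ) → Set
CoprimeFamily f = ∀ k → (∀ a → k ℕ.∣ f a) → k ℕ.∣ 1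

-- m / gcd(m, n) is coprime to n / gcd(m, n), so it divides every f a and hence is 1.
coprimeFamily-divisor : {A : Set} {f : A → ℕ} {m n : ℕ} .{{_ : NonZero m}} →
                        CoprimeFamily f → (∀ a → m ℕ.∣ f a ℕ.* n) → m ℕ.∣ n
coprimeFamily-divisor {f = f} {m} {n} coprime m∣fa*n = ℕ.∣-trans m∣g (gcd[m,n]∣n m n)
  where
  g : ℕ
  g = gcd m n

  instance
    g≢0 : NonZero g
    g≢0 = ℕ.≢-nonZero (gcd[m,n]≢0 m n (inj₁ (ℕ.≢-nonZero⁻¹ m)))

  fa*n≡n/g*fa*g : ∀ a → f a ℕ.* n ≡ n ℕ./ g ℕ.* f a ℕ.* g
  fa*n≡n/g*fa*g a = begin
    f a ℕ.* n                 ≡⟨ cong (f a ℕ.*_) (m/n*n≡m (gcd[m,n]∣n m n)) ⟨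
    f a ℕ.* (n ℕ./ g ℕ.* g)   ≡⟨ ℕ.*-assoc (f a) (n ℕ./ g) g ⟨
    f a ℕ.* (n ℕ./ g) ℕ.* g   ≡⟨ cong (ℕ._* g) (ℕ.*-comm (f a) (n ℕ./ g)) ⟩
    n ℕ./ g ℕ.* f a ℕ.* g     ∎

  m/g∣fa : ∀ a → m ℕ./ g ℕ.∣ f a
  m/g∣fa a = coprime-divisor (coprime-/gcd m n)
    (ℕ.m∣n*o⇒m/n∣o (gcd[m,n]∣m m n) (subst (m ℕ.∣_) (fa*n≡n/g*fa*g a) (m∣fa*n a)))

  m∣g : m ℕ.∣ g
  m∣g = subst (m ℕ.∣_) (ℕ.*-identityˡ g)
    (ℕ.m/n∣o⇒m∣o*n (gcd[m,n]∣m m n) (coprime (m ℕ./ g) m/g∣fa))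

/-injectiveˡ : ∀ {i j} n .{{_ : NonZero n}} → i / n ≡ j / n → i ≡ j
/-injectiveˡ {i} {j} (ℕ.suc n) i/n≡j/n with /-injective-≃ (mkℚᵘ i n) (mkℚᵘ j n) i/n≡j/n
... | *≡* i*n≡j*n = *-cancelʳ-≡ i j (+ ℕ.suc n) i*n≡j*n

lowerOK-mono : ∀ l {i j} → i ≤ j → LowerOK l i → LowerOK l j
lowerOK-mono nothing  _   _   = tt
lowerOK-mono (just _) i≤j l≤i = ≤-trans l≤i i≤j

upperOK-mono : ∀ u {i j} → i ≤ j → UpperOK u j → UpperOK u i
upperOK-mono nothing  _   _   = tt
upperOK-mono (just _) i≤j j≤u = ≤-trans i≤j j≤u

∈I-convex : ∀ I {i j k} → i ∈I I → k ∈I I → i ≤ j → j ≤ k → j ∈I I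
∈I-convex I (l≤i , _) (_ , k≤u) i≤j j≤k =
  lowerOK-mono (lower I) i≤j l≤i , upperOK-mono (upper I) j≤k k≤u

0∈I : ∀ I → 0ℤ ∈I I
0∈I I = has0 I , upperOK-mono (upper I) (+≤+ ℕ.z≤n) (has1 I)

1∈I : ∀ I → 1ℤ ∈I I
1∈I I = lowerOK-mono (lower I) (+≤+ ℕ.z≤n) (has0 I) , has1 I

∈I*⇒∈I : ∀ I {i} → i ∈I* I → i ∈I I
∈I*⇒∈I I {i} (i-1∈I , i+1∈I) = ∈I-convex I i-1∈I i+1∈I (i≤j⇒i-k≤j 1ℤ ≤-refl) (i≤i+j i 1ℤ)

∈I-induction : ∀ I (P : ℤ → Set) → P 0ℤ → P 1ℤ →
               (∀ i → i ∈I* I → P (i - 1ℤ) → P i → P (i + 1ℤ)) →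
               (∀ i → i ∈I* I → P i → P (i + 1ℤ) → P (i - 1ℤ)) →
               ∀ i → i ∈I I → P i
∈I-induction I P P0 P1 forward backward = λ where
    (+ ℕ.zero)    _   → P0
    (+ ℕ.suc n)   i∈I → proj₂ (upward n i∈I)
    -[1+ n ]      i∈I → proj₁ (downward n i∈I)
  where
  upward : ∀ n → (+ ℕ.suc n) ∈I I → P (+ n) × P (+ ℕ.suc n)
  upward ℕ.zero    _     = P0 , P1
  upward (ℕ.suc n) n+2∈I =
    P[n+1] , subst P n+1+1≡n+2 (forward (+ ℕ.suc n) n+1∈I* P[n] P[n+1])
    where
    n+1+1≡n+2 : + ℕ.suc n + 1ℤ ≡ + ℕ.suc (ℕ.suc n)
    n+1+1≡n+2 = cong +_ (ℕ.+-comm (ℕ.suc n) 1)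
    n+1∈I = ∈I-convex I (0∈I I) n+2∈I (+≤+ ℕ.z≤n) (+≤+ (ℕ.n≤1+n _))
    n∈I   = ∈I-convex I (0∈I I) n+1∈I (+≤+ ℕ.z≤n) (+≤+ (ℕ.n≤1+n _))
    n+1∈I* = n∈I , subst (_∈I I) (sym n+1+1≡n+2) n+2∈I
    P[n]×P[n+1] = upward n n+1∈I
    P[n] = proj₁ P[n]×P[n+1]
    P[n+1] = proj₂ P[n]×P[n+1]

  -[1+n]+1∈I : ∀ n → -[1+ n ] ∈I I → (-[1+ n ] + 1ℤ) ∈I I
  -[1+n]+1∈I ℕ.zero    _   = 0∈I I
  -[1+n]+1∈I (ℕ.suc n) n∈I = ∈I-convex I n∈I (0∈I I) (-≤- (ℕ.n≤1+n n)) -≤+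

  downward : ∀ n → -[1+ n ] ∈I I → P -[1+ n ] × P (-[1+ n ] + 1ℤ)
  downward ℕ.zero    -1∈I   = backward 0ℤ (-1∈I , 1∈I I) P0 P1 , P0
  downward (ℕ.suc n) -n-2∈I =
    subst P -n-1-1≡-n-2 (backward -[1+ n ] -n-1∈I* P[-n-1] P[-n]) , P[-n-1]
    where
    -n-1-1≡-n-2 : -[1+ n ] - 1ℤ ≡ -[1+ ℕ.suc n ]
    -n-1-1≡-n-2 = cong (-[1+_] ∘ ℕ.suc) (ℕ.+-identityʳ n)
    -n-1∈I = ∈I-convex I -n-2∈I (0∈I I) (-≤- (ℕ.n≤1+n n)) -≤+
    -n-1∈I* = subst (_∈I I) (sym -n-1-1≡-n-2) -n-2∈I , -[1+n]+1∈I n -n-1∈I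
    P[-n-1]×P[-n] = downward n -n-1∈I
    P[-n-1] = proj₁ P[-n-1]×P[-n]
    P[-n] = proj₂ P[-n-1]×P[-n]

-- A record rather than a Π-type so that its indices can be inferred: ℤ's _*_ unfolds eagerly.
record SolvesRecurrence (R : ℤ) (D : ℤ → ℤ) (I : IndexSet) (t : ℤ → ℤ) : Set where
  constructor solvesRecurrence
  field
    recurrence : ∀ i → i ∈I* I → R * (t (i - 1ℤ) + t (i + 1ℤ)) ≡ D i * t i

open SolvesRecurrence

module _ {R : ℤ} {D : ℤ → ℤ} {I : IndexSet} where

  solves-+ : ∀ {s t} → SolvesRecurrence R D I s → SolvesRecurrence R D I t →
             SolvesRecurrence R D I (λ i → s i + t i)
  solves-+ {s} {t} s-solves t-solves = solvesRecurrence λ i i∈I* → begin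
    R * ((s (i - 1ℤ) + t (i - 1ℤ)) + (s (i + 1ℤ) + t (i + 1ℤ)))
      ≡⟨ regroup R (s (i - 1ℤ)) (t (i - 1ℤ)) (s (i + 1ℤ)) (t (i + 1ℤ)) ⟩
    R * (s (i - 1ℤ) + s (i + 1ℤ)) + R * (t (i - 1ℤ) + t (i + 1ℤ))
      ≡⟨ cong₂ _+_ (recurrence s-solves i i∈I*) (recurrence t-solves i i∈I*) ⟩
    D i * s i + D i * t i
      ≡⟨ *-distribˡ-+ (D i) (s i) (t i) ⟨
    D i * (s i + t i)
      ∎
    where
    regroup : ∀ r a b c d → r * ((a + b) + (c + d)) ≡ r * (a + c) + r * (b + d)
    regroup = solve-∀

  solves-* : ∀ k {t} → SolvesRecurrence R D I t → SolvesRecurrence R D I (λ i → k * t i)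
  solves-* k {t} t-solves = solvesRecurrence λ i i∈I* → begin
    R * (k * t (i - 1ℤ) + k * t (i + 1ℤ))  ≡⟨ factor R k _ _ ⟩
    k * (R * (t (i - 1ℤ) + t (i + 1ℤ)))    ≡⟨ cong (k *_) (recurrence t-solves i i∈I*) ⟩
    k * (D i * t i)                        ≡⟨ swap k (D i) (t i) ⟩
    D i * (k * t i)                        ∎
    where
    factor : ∀ r k a b → r * (k * a + k * b) ≡ k * (r * (a + b))
    factor = solve-∀
    swap : ∀ k d a → k * (d * a) ≡ d * (k * a)
    swap = solve-∀

  solves-unique : ∀ {s t} .{{_ : ℤ.NonZero R}} →
                  SolvesRecurrence R D I s → SolvesRecurrence R D I t →
                  s 0ℤ ≡ t 0ℤ → s 1ℤ ≡ t 1ℤ → ∀ i → i ∈I I → s i ≡ t i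
  solves-unique {s} {t} s-solves t-solves s0≡t0 s1≡t1 =
    ∈I-induction I (λ i → s i ≡ t i) s0≡t0 s1≡t1
      (λ i i∈I* s₋≡t₋ sᵢ≡tᵢ → ∙-cancelˡ (t (i - 1ℤ)) _ _
         (trans (cong (_+ s (i + 1ℤ)) (sym s₋≡t₋)) (sums-agree i i∈I* sᵢ≡tᵢ)))
      (λ i i∈I* sᵢ≡tᵢ s₊≡t₊ → ∙-cancelʳ (t (i + 1ℤ)) _ _
         (trans (cong (λ x → s (i - 1ℤ) + x) (sym s₊≡t₊)) (sums-agree i i∈I* sᵢ≡tᵢ)))
    where
    sums-agree : ∀ i → i ∈I* I → s i ≡ t i → s (i - 1ℤ) + s (i + 1ℤ) ≡ t (i - 1ℤ) + t (i + 1ℤ)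
    sums-agree i i∈I* sᵢ≡tᵢ = *-cancelˡ-≡ R _ _ (begin
      R * (s (i - 1ℤ) + s (i + 1ℤ))  ≡⟨ recurrence s-solves i i∈I* ⟩
      D i * s i                      ≡⟨ cong (D i *_) sᵢ≡tᵢ ⟩
      D i * t i                      ≡⟨ recurrence t-solves i i∈I* ⟨
      R * (t (i - 1ℤ) + t (i + 1ℤ))  ∎)

solves-cong : ∀ {R D D′ I t} → (∀ i → i ∈I* I → D i ≡ D′ i) →
              SolvesRecurrence R D I t → SolvesRecurrence R D′ I t
solves-cong {t = t} D≡D′ t-solves = solvesRecurrence λ i i∈I* →
  trans (recurrence t-solves i i∈I*) (cong (_* t i) (D≡D′ i i∈I*))

linearForm : ℤ → ℤ → Vertex → ℤ
linearForm x y (a , b) = x * a + y * b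

-- solve-∀ does not unfold det or linearForm, so identities are proved in coordinates.
linearForm-* : ∀ k x y v → linearForm (x * k) (y * k) v ≡ k * linearForm x y v
linearForm-* k x y (a , b) = expanded k x y a b
  where
  expanded : ∀ k x y a b → x * k * a + y * k * b ≡ k * (x * a + y * b)
  expanded = solve-∀

ThreeTermRelation : (Vertex → ℤ) → Set
ThreeTermRelation c = ∀ u v w → det v w * c u + det u v * c w ≡ det u w * c v

three-term₁ : ThreeTermRelation proj₁
three-term₁ (a , b) (c , d) (e , f) = expanded a b c d e f
  where
  expanded : ∀ a b c d e f → (c * f - d * e) * a + (a * d - b * c) * e ≡ (a * f - b * e) * c
  expanded = solve-∀

three-term₂ : ThreeTermRelation proj₂
three-term₂ (a , b) (c , d) (e , f) = expanded a b c d e f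
  where
  expanded : ∀ a b c d e f → (c * f - d * e) * b + (a * d - b * c) * f ≡ (a * f - b * e) * d
  expanded = solve-∀

cramer₁ : ∀ x y u v → det u v * x ≡ linearForm x y u * proj₂ v - linearForm x y v * proj₂ u
cramer₁ x y (a , b) (c , d) = expanded x y a b c d
  where
  expanded : ∀ x y a b c d → (a * d - b * c) * x ≡ (x * a + y * b) * d - (x * c + y * d) * b
  expanded = solve-∀

cramer₂ : ∀ x y u v → det u v * y ≡ linearForm x y v * proj₁ u - linearForm x y u * proj₁ v
cramer₂ x y (a , b) (c , d) = expanded x y a b c d
  where
  expanded : ∀ x y a b c d → (a * d - b * c) * y ≡ (x * c + y * d) * a - (x * a + y * b) * c
  expanded = solve-∀

interpolation : ∀ t₀ t₁ u v →
  let x = t₀ * proj₂ v - t₁ * proj₂ u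
      y = t₁ * proj₁ u - t₀ * proj₁ v
  in linearForm x y u ≡ t₀ * det u v × linearForm x y v ≡ t₁ * det u v
interpolation t₀ t₁ (a , b) (c , d) = expanded₀ t₀ t₁ a b c d , expanded₁ t₀ t₁ a b c d
  where
  expanded₀ : ∀ t₀ t₁ a b c d → (t₀ * d - t₁ * b) * a + (t₁ * a - t₀ * c) * b ≡ t₀ * (a * d - b * c)
  expanded₀ = solve-∀
  expanded₁ : ∀ t₀ t₁ a b c d → (t₀ * d - t₁ * b) * c + (t₁ * a - t₀ * c) * d ≡ t₁ * (a * d - b * c)
  expanded₁ = solve-∀

det-linearForms : ∀ p q r s u v →
  det (linearForm p q u , linearForm r s u) (linearForm p q v , linearForm r s v) ≡ (p * s - q * r) * det u v
det-linearForms p q r s (a , b) (c , d) = expanded p q r s a b c d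
  where
  expanded : ∀ p q r s a b c d →
    (p * a + q * b) * (r * c + s * d) - (r * a + s * b) * (p * c + q * d) ≡ (p * s - q * r) * (a * d - b * c)
  expanded = solve-∀

itineraryNumerator : (ℤ → Vertex) → ℤ → ℤ
itineraryNumerator γ i = det (γ (i - 1ℤ)) (γ (i + 1ℤ))

module _ {R : ℕ} {I : IndexSet} {γ : ℤ → Vertex} (γ-path : IsPath R I γ) where

  edge₀₁ : det (γ 0ℤ) (γ 1ℤ) ≡ + R
  edge₀₁ = IsPath.edge γ-path 1ℤ (1∈I I , 0∈I I)

  edges-around : ∀ {i} → i ∈I* I → det (γ (i - 1ℤ)) (γ i) ≡ + R × det (γ i) (γ (i + 1ℤ)) ≡ + R
  edges-around {i} i∈I*@(i-1∈I , i+1∈I) =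
    IsPath.edge γ-path i (i∈I , i-1∈I) ,
    subst (λ j → det (γ j) (γ (i + 1ℤ)) ≡ + R) i+1-1≡i
      (IsPath.edge γ-path (i + 1ℤ) (i+1∈I , subst (_∈I I) (sym i+1-1≡i) i∈I))
    where
    i∈I = ∈I*⇒∈I I i∈I*
    i+1-1≡i : i + 1ℤ - 1ℤ ≡ i
    i+1-1≡i = trans (+-assoc i 1ℤ (- 1ℤ)) (+-identityʳ i)

  path-solves : ∀ {c} → ThreeTermRelation c → SolvesRecurrence (+ R) (itineraryNumerator γ) I (c ∘ γ)
  path-solves {c} three-term = solvesRecurrence recurrence-at
    where
    recurrence-at : ∀ i → i ∈I* I →
                    + R * (c (γ (i - 1ℤ)) + c (γ (i + 1ℤ))) ≡ itineraryNumerator γ i * c (γ i)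
    recurrence-at i i∈I* = begin
      + R * (c γ₋ + c γ₊)
        ≡⟨ *-distribˡ-+ (+ R) (c γ₋) (c γ₊) ⟩
      + R * c γ₋ + + R * c γ₊
        ≡⟨ cong₂ (λ r r′ → r * c γ₋ + r′ * c γ₊) γᵢγ₊≡R γ₋γᵢ≡R ⟨
      det γᵢ γ₊ * c γ₋ + det γ₋ γᵢ * c γ₊
        ≡⟨ three-term γ₋ γᵢ γ₊ ⟩
      det γ₋ γ₊ * c γᵢ
        ∎
      where
      γ₋ γᵢ γ₊ : Vertex
      γ₋ = γ (i - 1ℤ)
      γᵢ = γ i
      γ₊ = γ (i + 1ℤ)
      γ₋γᵢ≡R = proj₁ (edges-around i∈I*)
      γᵢγ₊≡R = proj₂ (edges-around i∈I*)

minimal⇒∣-coefficients : ∀ {R} .{{_ : NonZero R}} {I γ} x y → Minimal I γ →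
                         (∀ {i} → i ∈I I → + R Signed.∣ linearForm x y (γ i)) →
                         + R Signed.∣ x × + R Signed.∣ y
minimal⇒∣-coefficients {R} {I} {γ} x y γ-minimal R∣form =
  ∣coefficient (λ {i} {j} i∈I j∈I →
    R∣cramer (proj₂ (γ i)) (proj₂ (γ j)) (cramer₁ x y (γ j) (γ i)) (R∣form j∈I) (R∣form i∈I)) ,
  ∣coefficient (λ {i} {j} i∈I j∈I →
    R∣cramer (proj₁ (γ j)) (proj₁ (γ i)) (cramer₂ x y (γ j) (γ i)) (R∣form i∈I) (R∣form j∈I))
  where
  R∣cramer : ∀ {e f g} a b → e ≡ f * a - g * b → + R Signed.∣ f → + R Signed.∣ g → + R Signed.∣ e
  R∣cramer a b e≡ R∣f R∣g =
    subst (+ R Signed.∣_) (sym e≡)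
      (Signed.∣m∣n⇒∣m-n (Signed.∣m⇒∣m*n a R∣f) (Signed.∣m⇒∣m*n b R∣g))

  dets : (Σ[ i ∈ ℤ ] Σ[ j ∈ ℤ ] i ∈I I × j ∈I I) → ℕ
  dets (i , j , _) = ∣ det (γ j) (γ i) ∣

  ∣coefficient : ∀ {z} → (∀ {i j} → i ∈I I → j ∈I I → + R Signed.∣ det (γ j) (γ i) * z) →
                 + R Signed.∣ z
  ∣coefficient {z} R∣det*z = Signed.∣ᵤ⇒∣ (coprimeFamily-divisor {f = dets} {R} {∣ z ∣}
    (λ k k∣dets → γ-minimal (+ k) (λ i j i∈I j∈I → k∣dets (i , j , i∈I , j∈I)))
    (λ (i , j , i∈I , j∈I) →
       subst (R ℕ.∣_) (abs-* (det (γ j) (γ i)) z) (Signed.∣⇒∣ᵤ (R∣det*z i∈I j∈I))))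

LinearAlong : IndexSet → (ℤ → Vertex) → (ℤ → ℤ) → Set
LinearAlong I γ t = Σ[ x ∈ ℤ ] Σ[ y ∈ ℤ ] (∀ i → i ∈I I → linearForm x y (γ i) ≡ t i)

solution-linearAlong : ∀ {R} .{{_ : NonZero R}} {I γ t} → IsPath R I γ → Minimal I γ →
                       SolvesRecurrence (+ R) (itineraryNumerator γ) I t → LinearAlong I γ t
solution-linearAlong {R} {I} {γ} {t} γ-path γ-minimal t-solves = x/R , y/R , λ i i∈I →
  *-cancelˡ-≡ (+ R) _ _ (begin
    + R * linearForm x/R y/R (γ i)
      ≡⟨ linearForm-* (+ R) x/R y/R (γ i) ⟨
    linearForm (x/R * + R) (y/R * + R) (γ i)
      ≡⟨ cong₂ (λ x′ y′ → linearForm x′ y′ (γ i)) x≡x/R*R y≡y/R*R ⟨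
    linearForm x y (γ i)
      ≡⟨ form≡R*t i i∈I ⟩
    + R * t i
      ∎)
  where
  -- Cramer's rule for linearForm x y (γ i) ≡ + R * t i at i = 0, 1, using det (γ 0) (γ 1) ≡ + R.
  x y : ℤ
  x = t 0ℤ * proj₂ (γ 1ℤ) - t 1ℤ * proj₂ (γ 0ℤ)
  y = t 1ℤ * proj₁ (γ 0ℤ) - t 0ℤ * proj₁ (γ 1ℤ)

  form-solves : SolvesRecurrence (+ R) (itineraryNumerator γ) I (λ i → linearForm x y (γ i))
  form-solves = solves-+ {s = λ i → x * proj₁ (γ i)} {t = λ i → y * proj₂ (γ i)}
    (solves-* x (path-solves γ-path three-term₁)) (solves-* y (path-solves γ-path three-term₂))

  scaled-edge : ∀ k → k * det (γ 0ℤ) (γ 1ℤ) ≡ + R * k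
  scaled-edge k = trans (cong (k *_) (edge₀₁ γ-path)) (*-comm k (+ R))

  form≡R*t : ∀ i → i ∈I I → linearForm x y (γ i) ≡ + R * t i
  form≡R*t = solves-unique form-solves (solves-* (+ R) t-solves)
    (trans (proj₁ (interpolation (t 0ℤ) (t 1ℤ) (γ 0ℤ) (γ 1ℤ))) (scaled-edge (t 0ℤ)))
    (trans (proj₂ (interpolation (t 0ℤ) (t 1ℤ) (γ 0ℤ) (γ 1ℤ))) (scaled-edge (t 1ℤ)))

  R∣x×R∣y : + R Signed.∣ x × + R Signed.∣ y
  R∣x×R∣y = minimal⇒∣-coefficients {I = I} {γ} x y γ-minimal
    (λ {i} i∈I → Signed.divides (t i) (trans (form≡R*t i i∈I) (*-comm (+ R) (t i))))
  x/R = Signed.quotient (proj₁ R∣x×R∣y)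
  y/R = Signed.quotient (proj₂ R∣x×R∣y)
  x≡x/R*R = Signed._∣_.equality (proj₁ R∣x×R∣y)
  y≡y/R*R = Signed._∣_.equality (proj₂ R∣x×R∣y)

linearAlong⇒SL2Equivalent : ∀ {R} .{{_ : NonZero R}} {I γ δ} → IsPath R I γ → IsPath R I δ →
                            LinearAlong I γ (proj₁ ∘ δ) → LinearAlong I γ (proj₂ ∘ δ) →
                            SL2Equivalent I γ δ
linearAlong⇒SL2Equivalent {R} {I} {γ} {δ} γ-path δ-path (p , q , row₁) (r , s , row₂) =
  record { p = p ; q = q ; r = r ; s = s ; det≡1 = unimodular } , maps
  where
  maps : ∀ i → i ∈I I → (linearForm p q (γ i) , linearForm r s (γ i)) ≡ δ i
  maps i i∈I = cong₂ _,_ (row₁ i i∈I) (row₂ i i∈I)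

  unimodular : p * s - q * r ≡ 1ℤ
  unimodular = *-cancelʳ-≡ _ _ (+ R) (begin
    (p * s - q * r) * + R
      ≡⟨ cong ((p * s - q * r) *_) (edge₀₁ γ-path) ⟨
    (p * s - q * r) * det (γ 0ℤ) (γ 1ℤ)
      ≡⟨ det-linearForms p q r s (γ 0ℤ) (γ 1ℤ) ⟨
    det (linearForm p q (γ 0ℤ) , linearForm r s (γ 0ℤ)) (linearForm p q (γ 1ℤ) , linearForm r s (γ 1ℤ))
      ≡⟨ cong₂ det (maps 0ℤ (0∈I I)) (maps 1ℤ (1∈I I)) ⟩
    det (δ 0ℤ) (δ 1ℤ)
      ≡⟨ edge₀₁ δ-path ⟩
    + R
      ≡⟨ *-identityˡ (+ R) ⟨
    1ℤ * + R
      ∎)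

theorem2p3 : (R : ℕ) → .{{_ : NonZero R}} → (I : IndexSet) → (γ δ : ℤ → Vertex)
    → IsPath R I γ → IsPath R I δ → Minimal I γ → Minimal I δ
    → (∀ i → i ∈I* I → itinerary R γ i ≡ itinerary R δ i)
    → SL2Equivalent I γ δ
theorem2p3 R I γ δ γ-path δ-path γ-minimal _ same-itinerary =
  linearAlong⇒SL2Equivalent γ-path δ-path
    (coordinate-linearAlong three-term₁) (coordinate-linearAlong three-term₂)
  where
  same-numerators : ∀ i → i ∈I* I → itineraryNumerator δ i ≡ itineraryNumerator γ i
  same-numerators i i∈I* = /-injectiveˡ R (sym (same-itinerary i i∈I*))

  coordinate-linearAlong : ∀ {c} → ThreeTermRelation c → LinearAlong I γ (c ∘ δ)
  coordinate-linearAlong three-term =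
    solution-linearAlong γ-path γ-minimal (solves-cong same-numerators (path-solves δ-path three-term))
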